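{- The chromatic number is stable under 2-switch: for every graph $G$ and every 2-switch $\tau$, $|\chi(\tau(G))-\chi(G)|\le 1$.
   Context: Graphs are finite, simple, undirected and labeled. $\chi(G)$ is the chromatic number of $G$. For vertices $a,b,c,d$, the 2-switch $\tau=\binom{a\ b}{c\ d}$ maps $G$ to $G-ab-cd+ac+bd$ if $ab,cd\in E(G)$, $\{a,b\}\cap\{c,d\}=\varnothing$ and $ac,bd\notin E(G)$, and to $G$ otherwise. -}

module Defs where

open import Data.Nat using (ℕ; _≤_; _+_)
import Data.Nat
open import Data.Fin using (Fin; _≟_)
open import Data.Bool using (Bool; true; false; if_then_else_; _∧_; _∨_; not)
open import Relation.Nullary using (¬_; Dec; yes; no)
open import Relation.Nullary.Decidable using (⌊_⌋)
open import Relation.Binary.PropositionalEquality using (_≡_; refl; sym; cong; cong₂; trans)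
open import Data.Bool.Properties using (∧-comm; ∨-comm)

open import Data.Product using (Σ; ∃; _×_; _,_)
open import Data.Integer using (ℤ; +_; ∣_∣; _-_)

record Graph (n : ℕ) : Set where
  field
    adj   : Fin n → Fin n → Bool
    adj-sym : ∀ x y → adj x y ≡ adj y x
    adj-irrefl : ∀ x → adj x x ≡ false
open Graph public

_==_ : ∀ {n} → Fin n → Fin n → Bool
x == y = ⌊ x ≟ y ⌋

samePair : ∀ {n} → Fin n → Fin n → Fin n → Fin n → Bool
samePair x y u v = ((x == u) ∧ (y == v)) ∨ ((x == v) ∧ (y == u))

applicable : ∀ {n} → Graph n → Fin n → Fin n → Fin n → Fin n → Bool
applicable G a b c d =
  adj G a b ∧ adj G c d
  ∧ not ((a == c) ∨ (a == d) ∨ (b == c) ∨ (b == d))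
  ∧ not (adj G a c) ∧ not (adj G b d)

switchedAdj : ∀ {n} → Graph n → Fin n → Fin n → Fin n → Fin n → Fin n → Fin n → Bool
switchedAdj G a b c d x y =
  if x == y then false
  else if samePair x y a b ∨ samePair x y c d then false
  else if samePair x y a c ∨ samePair x y b d then true
  else adj G x y


==-sym : ∀ {n} (x y : Fin n) → (x == y) ≡ (y == x)
==-sym x y with x ≟ y | y ≟ x
... | yes _ | yes _ = refl
... | no _  | no _  = refl
... | yes p | no q  = Relation.Nullary.contradiction (sym p) q
  where import Relation.Nullary
... | no p  | yes q = Relation.Nullary.contradiction (sym q) p
  where import Relation.Nullary

==-refl : ∀ {n} (x : Fin n) → (x == x) ≡ true
==-refl x with x ≟ x
... | yes _ = refl
... | no p = Relation.Nullary.contradiction refl p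
  where import Relation.Nullary

samePair-sym : ∀ {n} (x y u v : Fin n) → samePair x y u v ≡ samePair y x u v
samePair-sym x y u v =
  trans (∨-comm ((x == u) ∧ (y == v)) ((x == v) ∧ (y == u)))
        (cong₂ _∨_ (∧-comm (x == v) (y == u)) (∧-comm (x == u) (y == v)))

switchedAdj-sym : ∀ {n} (G : Graph n) a b c d x y →
  switchedAdj G a b c d x y ≡ switchedAdj G a b c d y x
switchedAdj-sym G a b c d x y
  rewrite ==-sym x y | samePair-sym x y a b | samePair-sym x y c d
        | samePair-sym x y a c | samePair-sym x y b d | Graph.adj-sym G x y = refl

switchedAdj-irrefl : ∀ {n} (G : Graph n) a b c d x → switchedAdj G a b c d x x ≡ false
switchedAdj-irrefl G a b c d x rewrite ==-refl x = refl

twoSwitch : ∀ {n} → Fin n → Fin n → Fin n → Fin n → Graph n → Graph n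
twoSwitch a b c d G with applicable G a b c d
... | false = G
... | true  = record
  { adj    = switchedAdj G a b c d
  ; adj-sym = switchedAdj-sym G a b c d
  ; adj-irrefl = switchedAdj-irrefl G a b c d }

IsColouring : ∀ {n} (G : Graph n) (k : ℕ) → (Fin n → Fin k) → Set
IsColouring G k f = ∀ x y → adj G x y ≡ true → ¬ (f x ≡ f y)

Colourable : ∀ {n} → Graph n → ℕ → Set
Colourable {n} G k = Σ (Fin n → Fin k) (IsColouring G k)

IsChromaticNumber : ∀ {n} → Graph n → ℕ → Set
IsChromaticNumber G k = Colourable G k × (∀ j → j Data.Nat.< k → ¬ Colourable G j)

-- A proper k-colouring of G becomes a proper (k+1)-colouring of τ(G) once a and b get a
-- fresh colour: the new edges ac and bd meet {a, b}, and ab is no longer an edge. Symmetrically,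
-- {a, c} is independent in G and meets both deleted edges ab and cd, so recolouring it turns a
-- k-colouring of τ(G) into a (k+1)-colouring of G. Hence χ(τ(G)) ≤ χ(G) + 1 and χ(G) ≤ χ(τ(G)) + 1.
module Submission where

open import Defs
open import Data.Nat using (ℕ; suc; _≤_; _∸_; _≤?_)
open import Data.Nat.Properties using (≤-total; ≰⇒>; ≤-trans; ≤-reflexive; ∸-monoˡ-≤; m+n∸n≡m)
open import Data.Fin using (Fin; _≟_; fromℕ; inject₁)
open import Data.Fin.Properties using (fromℕ≢inject₁; inject₁-injective)
open import Data.Integer using (+_; ∣_∣; _-_)
open import Data.Integer.Properties using (m-n≡m⊖n; ⊖-≥; ∣m⊖n∣≡∣n⊖m∣)
open import Data.Bool using (Bool; true; false; if_then_else_; _∧_; _∨_; not)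
open import Data.Bool.Properties using (∨-conicalˡ; ∨-conicalʳ; ∧-zeroʳ)
open import Data.Product using (_×_; _,_; proj₁)
open import Data.Sum using (_⊎_; inj₁; inj₂)
open import Data.Empty using (⊥-elim)
open import Relation.Nullary using (yes; no; contradiction)
open import Relation.Binary.PropositionalEquality using (_≡_; refl; sym; trans; cong₂)

private
  variable
    n k : ℕ

==⇒≡ : (x y : Fin n) → x == y ≡ true → x ≡ y
==⇒≡ x y x==y with x ≟ y
... | yes x≡y = x≡y

adjacent⇒distinct : (G : Graph n) {x y : Fin n} → adj G x y ≡ true → x == y ≡ false
adjacent⇒distinct G {x} {y} xy∈G with x ≟ y
... | no _     = refl
... | yes refl = contradiction (trans (sym xy∈G) (adj-irrefl G x)) λ ()

samePair-absent : (x y u v : Fin n) → x == u ≡ false → y == u ≡ false → samePair x y u v ≡ false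
samePair-absent x y u v x≢u y≢u = lemma (x == u) (y == v) (x == v) (y == u) x≢u y≢u
  where
  lemma : ∀ xu yv xv yu → xu ≡ false → yu ≡ false → (xu ∧ yv) ∨ (xv ∧ yu) ≡ false
  lemma false yv xv false refl refl = ∧-zeroʳ xv

samePair-refl : (u v : Fin n) → samePair u v u v ≡ true
samePair-refl u v rewrite ==-refl u | ==-refl v = refl

pair : Fin n → Fin n → Fin n → Bool
pair u v x = x == u ∨ x == v

pair-member : (u v x : Fin n) → pair u v x ≡ true → x ≡ u ⊎ x ≡ v
pair-member u v x x∈ with x == u in x≡u
... | true  = inj₁ (==⇒≡ x u x≡u)
... | false = inj₂ (==⇒≡ x v x∈)

pair-absent : (u v x : Fin n) → pair u v x ≡ false → x == u ≡ false × x == v ≡ false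
pair-absent u v x x∉ = ∨-conicalˡ (x == u) (x == v) x∉ , ∨-conicalʳ (x == u) (x == v) x∉

samePair-avoiding : (u v w w′ x y : Fin n) → pair u v x ≡ false → pair u v y ≡ false →
                    samePair x y u w ∨ samePair x y v w′ ≡ false
samePair-avoiding u v w w′ x y x∉ y∉ =
  let (x≢u , x≢v) = pair-absent u v x x∉
      (y≢u , y≢v) = pair-absent u v y y∉
  in  cong₂ _∨_ (samePair-absent x y u w x≢u y≢u) (samePair-absent x y v w′ x≢v y≢v)

pair-independent : (H : Graph n) {u v : Fin n} → adj H u v ≡ false →
                   ∀ x y → pair u v x ≡ true → pair u v y ≡ true → adj H x y ≡ false
pair-independent H {u} {v} uv∉H x y x∈ y∈ with pair-member u v x x∈ | pair-member u v y y∈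
... | inj₁ refl | inj₁ refl = adj-irrefl H x
... | inj₁ refl | inj₂ refl = uv∉H
... | inj₂ refl | inj₁ refl = trans (adj-sym H x y) uv∉H
... | inj₂ refl | inj₂ refl = adj-irrefl H x

module _ (G : Graph n) (a b c d x y : Fin n) where

  switchedAdj-removed : samePair x y a b ≡ true → switchedAdj G a b c d x y ≡ false
  switchedAdj-removed = lemma (x == y) (samePair x y c d) (samePair x y a c ∨ samePair x y b d) (adj G x y)
    where
    lemma : ∀ loop {ab} cd added old → ab ≡ true →
            (if loop then false else if ab ∨ cd then false else if added then true else old) ≡ false
    lemma true  cd added old refl = refl
    lemma false cd added old refl = refl

  switchedAdj⇒adj : samePair x y a c ∨ samePair x y b d ≡ false →
                    switchedAdj G a b c d x y ≡ true → adj G x y ≡ true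
  switchedAdj⇒adj = lemma (x == y) (samePair x y a b ∨ samePair x y c d) (adj G x y)
    where
    lemma : ∀ loop removed {added} old → added ≡ false →
            (if loop then false else if removed then false else if added then true else old) ≡ true → old ≡ true
    lemma false false old refl e = e

  adj⇒switchedAdj : x == y ≡ false → samePair x y a b ∨ samePair x y c d ≡ false →
                    adj G x y ≡ true → switchedAdj G a b c d x y ≡ true
  adj⇒switchedAdj = lemma (samePair x y a c ∨ samePair x y b d)
    where
    lemma : ∀ added {loop removed old} → loop ≡ false → removed ≡ false → old ≡ true →
            (if loop then false else if removed then false else if added then true else old) ≡ true
    lemma true  refl refl refl = refl
    lemma false refl refl refl = refl

colourable-suc : (G H : Graph n) (S : Fin n → Bool) →
                 (∀ x y → S x ≡ true → S y ≡ true → adj H x y ≡ false) →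
                 (∀ x y → S x ≡ false → S y ≡ false → adj H x y ≡ true → adj G x y ≡ true) →
                 Colourable G k → Colourable H (suc k)
colourable-suc {n} {k} G H S independent off-S⊆G (f , proper) = f′ , proper′
  where
  f′ : Fin n → Fin (suc k)
  f′ x = if S x then fromℕ k else inject₁ (f x)

  proper′ : IsColouring H (suc k) f′
  proper′ x y xy∈H with S x in x∈S | S y in y∈S
  ... | true  | true  = contradiction (trans (sym xy∈H) (independent x y x∈S y∈S)) λ ()
  ... | true  | false = fromℕ≢inject₁
  ... | false | true  = λ eq → fromℕ≢inject₁ (sym eq)
  ... | false | false = λ eq → proper x y (off-S⊆G x y x∈S y∈S xy∈H) (inject₁-injective eq)

colourable-weaken : (G : Graph n) → Colourable G k → Colourable G (suc k)
colourable-weaken G = colourable-suc G G (λ _ → false) (λ _ _ ()) (λ _ _ _ _ xy∈G → xy∈G)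

applicable⇒ac∉G : (G : Graph n) (a b c d : Fin n) → applicable G a b c d ≡ true → adj G a c ≡ false
applicable⇒ac∉G G a b c d =
  lemma (adj G a b) (adj G c d) (not ((a == c) ∨ (a == d) ∨ (b == c) ∨ (b == d))) (adj G a c) (not (adj G b d))
  where
  lemma : ∀ ab cd disjoint ac bd → ab ∧ cd ∧ disjoint ∧ not ac ∧ bd ≡ true → ac ≡ false
  lemma true true true false bd _ = refl

module _ {G : Graph n} {a b c d : Fin n} where

  private
    switched : Graph n
    switched = record
      { adj        = switchedAdj G a b c d
      ; adj-sym    = switchedAdj-sym G a b c d
      ; adj-irrefl = switchedAdj-irrefl G a b c d
      }

  colourable-twoSwitch : Colourable G k → Colourable (twoSwitch a b c d G) (suc k)
  colourable-twoSwitch with applicable G a b c d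
  ... | false = colourable-weaken G
  ... | true  = colourable-suc G switched (pair a b) (pair-independent switched ab∉τG) off-ab
    where
    ab∉τG : switchedAdj G a b c d a b ≡ false
    ab∉τG = switchedAdj-removed G a b c d a b (samePair-refl a b)
    off-ab : ∀ x y → pair a b x ≡ false → pair a b y ≡ false →
             switchedAdj G a b c d x y ≡ true → adj G x y ≡ true
    off-ab x y x∉ y∉ = switchedAdj⇒adj G a b c d x y (samePair-avoiding a b c d x y x∉ y∉)

  colourable-twoSwitch⁻ : Colourable (twoSwitch a b c d G) k → Colourable G (suc k)
  colourable-twoSwitch⁻ with applicable G a b c d in app
  ... | false = colourable-weaken G
  ... | true  = colourable-suc switched G (pair a c) (pair-independent G (applicable⇒ac∉G G a b c d app))
                                 off-ac
    where
    off-ac : ∀ x y → pair a c x ≡ false → pair a c y ≡ false →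
             adj G x y ≡ true → switchedAdj G a b c d x y ≡ true
    off-ac x y x∉ y∉ xy∈G =
      adj⇒switchedAdj G a b c d x y (adjacent⇒distinct G xy∈G) (samePair-avoiding a c b d x y x∉ y∉) xy∈G

chromatic-≤ : (H : Graph n) {χ : ℕ} → IsChromaticNumber H χ → Colourable H k → χ ≤ k
chromatic-≤ {k = k} H {χ} (_ , minimal) colourable with χ ≤? k
... | yes χ≤k = χ≤k
... | no  χ≰k = ⊥-elim (minimal k (≰⇒> χ≰k) colourable)

m≤1+n⇒m∸n≤1 : ∀ {m} n → m ≤ suc n → m ∸ n ≤ 1
m≤1+n⇒m∸n≤1 n m≤1+n = ≤-trans (∸-monoˡ-≤ n m≤1+n) (≤-reflexive (m+n∸n≡m 1 n))

∣m-n∣≤1 : ∀ m n → m ≤ suc n → n ≤ suc m → ∣ + m - + n ∣ ≤ 1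
∣m-n∣≤1 m n m≤1+n n≤1+m rewrite m-n≡m⊖n m n with ≤-total n m
... | inj₁ n≤m rewrite ⊖-≥ n≤m = m≤1+n⇒m∸n≤1 n m≤1+n
... | inj₂ m≤n rewrite ∣m⊖n∣≡∣n⊖m∣ m n | ⊖-≥ m≤n = m≤1+n⇒m∸n≤1 m n≤1+m

theorem13 : ∀ {n} (G : Graph n) (a b c d : Fin n) (χG χτG : ℕ) →
    IsChromaticNumber G χG → IsChromaticNumber (twoSwitch a b c d G) χτG →
    ∣ (+ χτG) - (+ χG) ∣ ≤ 1
theorem13 G a b c d χG χτG χ[G] χ[τG] = ∣m-n∣≤1 χτG χG
  (chromatic-≤ (twoSwitch a b c d G) χ[τG] (colourable-twoSwitch (proj₁ χ[G])))
  (chromatic-≤ G χ[G] (colourable-twoSwitch⁻ (proj₁ χ[τG])))
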